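{- Let $n\ge 2$ and let $P=(v_1,e_1,v_2,\dots,e_{n-1},v_n)$ be a path graph with edges $e_i=\{v_i,v_{i+1}\}$, $i=1,\dots,n-1$, unit edge lengths $\ell\equiv 1$ and unit interdiction costs $b\equiv 1$. Let the interdiction budget be $B\le n-1$ and the number of locations be $p=B+1$. Then an optimal interdiction strategy for the $p$-median location interdiction problem is obtained by successively interdicting edges incident to leaves (of the current remaining path), i.e. by interdicting $B$ edges such that the resulting graph consists of $B$ isolated vertices and one path with $n-1-B$ edges.
   Context: $p$-median location interdiction problem (optimization version): given an undirected graph $G=(V,E)$, edge lengths $\ell$, interdiction costs $b$, budget $B$ and integer $p$, an interdiction strategy is a vector $\gamma\in\{0,1\}^{E}$ with $\sum_{e} b(e)\gamma_e\le B$, inducing $G(\gamma)=(V,E\setminus\{e:\gamma_e=1\})$. Its value is $\min_{X\subseteq V,|X|=p}\sum_{v\in V} d_{G(\gamma)}(v,X)$, where $d_{G(\gamma)}(v,X)=\min_{x\in X} d_{G(\gamma)}(v,x)$ and $d_{G(\gamma)}$ is the shortest-path distance in $G(\gamma)$ w.r.t. $\ell$. A strategy is optimal if it maximizes this value over all interdiction strategies. -}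

module Defs where

open import Data.Nat using (ℕ; zero; suc; _+_; _∸_; _≤_; _<_; _⊓_)
open import Data.Bool using (Bool; true; false; if_then_else_)
open import Data.Fin using (Fin; toℕ; inject₁)
open import Data.Fin.Subset using (Subset; ∣_∣)
open import Data.Vec using (lookup)
open import Data.List using (List; foldr; map)
open import Data.Nat.ListAction using () renaming (sum to sumL)
open import Data.Fin.Properties using (_≟_)
open import Data.List.Base using ()
open import Data.Product using (Σ; _×_; _,_; ∃)
open import Data.Sum using (_⊎_)
open import Relation.Binary.PropositionalEquality using (_≡_)
open import Relation.Nullary using (¬_; does)
open import Data.Empty using (⊥)
open import Data.Unit using (⊤)

-- Extended naturals ℕ ∪ {∞} (distances in a disconnected graph may be ∞)

data ℕ∞ : Set where
  fin : ℕ → ℕ∞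
  ∞   : ℕ∞

_+∞_ : ℕ∞ → ℕ∞ → ℕ∞
fin a +∞ fin b = fin (a + b)
fin _ +∞ ∞     = ∞
∞     +∞ _     = ∞

_⊓∞_ : ℕ∞ → ℕ∞ → ℕ∞
fin a ⊓∞ fin b = fin (a ⊓ b)
fin a ⊓∞ ∞     = fin a
∞     ⊓∞ y     = y

data _≤∞_ : ℕ∞ → ℕ∞ → Set where
  fin≤fin : ∀ {a b} → a ≤ b → fin a ≤∞ fin b
  x≤∞     : ∀ {x} → x ≤∞ ∞

-- A finite undirected (multi)graph: vertices Fin N, edges Fin M,
-- each edge with two end vertices.

record Graph : Set where
  field
    N    : ℕ
    M    : ℕ
    ends : Fin M → Fin N × Fin N

open Graph public

-- an interdiction strategy: γ e ≡ true means edge e is interdicted (removed)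
Strategy : Graph → Set
Strategy G = Fin (M G) → Bool

Joins : (G : Graph) → Fin (M G) → Fin (N G) → Fin (N G) → Set
Joins G e u w with ends G e
... | (a , c) = (a ≡ u × c ≡ w) ⊎ (a ≡ w × c ≡ u)

data Walk (G : Graph) (ℓ : Fin (M G) → ℕ) (γ : Strategy G)
          : Fin (N G) → Fin (N G) → ℕ → Set where
  nil  : ∀ {u} → Walk G ℓ γ u u 0
  step : ∀ {u w v d} (e : Fin (M G)) → γ e ≡ false → Joins G e u w →
         Walk G ℓ γ w v d → Walk G ℓ γ u v (ℓ e + d)

IsDist : (G : Graph) (ℓ : Fin (M G) → ℕ) (γ : Strategy G) →
         Fin (N G) → Fin (N G) → ℕ∞ → Set
IsDist G ℓ γ u v (fin d) = Walk G ℓ γ u v d × (∀ k → Walk G ℓ γ u v k → d ≤ k)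
IsDist G ℓ γ u v ∞       = ∀ k → ¬ Walk G ℓ γ u v k

allF : ∀ k → List (Fin k)
allF k = Data.List.Base.allFin k

distToSet : ∀ {k} → (Fin k → Fin k → ℕ∞) → Subset k → Fin k → ℕ∞
distToSet {k} D X v =
  foldr (λ x acc → if lookup X x then D v x ⊓∞ acc else acc) ∞ (allF k)

sum∞ : List ℕ∞ → ℕ∞
sum∞ = foldr _+∞_ (fin 0)

medianCost : ∀ {k} → (Fin k → Fin k → ℕ∞) → Subset k → ℕ∞
medianCost {k} D X = sum∞ (map (distToSet D X) (allF k))

IsMinCost : ∀ {k} → (Fin k → Fin k → ℕ∞) → ℕ → ℕ∞ → Set
IsMinCost {k} D p w =
  (Σ (Subset k) λ X → ∣ X ∣ ≡ p × medianCost D X ≡ w) ×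
  (∀ (X : Subset k) → ∣ X ∣ ≡ p → w ≤∞ medianCost D X)

IsValue : (G : Graph) (ℓ : Fin (M G) → ℕ) (p : ℕ) (γ : Strategy G) → ℕ∞ → Set
IsValue G ℓ p γ w =
  Σ (Fin (N G) → Fin (N G) → ℕ∞) λ D →
    (∀ u v → IsDist G ℓ γ u v (D u v)) × IsMinCost D p w

interdictionCost : (G : Graph) → (Fin (M G) → ℕ) → Strategy G → ℕ
interdictionCost G b γ =
  sumL (map (λ e → if γ e then b e else 0) (allF (M G)))

Feasible : (G : Graph) (b : Fin (M G) → ℕ) (B : ℕ) → Strategy G → Set
Feasible G b B γ = interdictionCost G b γ ≤ B

IsOptimal : (G : Graph) (ℓ b : Fin (M G) → ℕ) (B p : ℕ) → Strategy G → Set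
IsOptimal G ℓ b B p γ =
  Feasible G b B γ ×
  Σ ℕ∞ λ w → IsValue G ℓ p γ w ×
    (∀ γ' → Feasible G b B γ' → ∀ w' → IsValue G ℓ p γ' w' → w' ≤∞ w)

-- The path graph on n = suc m vertices v_0,…,v_m with edges e_j = {v_j, v_{j+1}}

PathGraph : ℕ → Graph
PathGraph m = record { N = suc m ; M = m ; ends = λ j → (inject₁ j , Fin.suc j) }
  where import Data.Fin as Fin

one : ∀ {m} → Fin m → ℕ
one _ = 1

-- successive leaf interdiction: remove the first i edges and the last (B ∸ i)
-- edges of the path (0-indexed edge j removed iff j < i or j ≥ m ∸ (B ∸ i))
leafStrategy : (m B i : ℕ) → Strategy (PathGraph m)
leafStrategy m B i j =
  does (Data.Nat._<?_ (toℕ j) i) Data.Bool.∨ does (Data.Nat._≤?_ (m ∸ (B ∸ i)) (toℕ j))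
  where import Data.Nat
        import Data.Bool

-- Removing c ≤ B edges splits the path on m + 1 vertices into c + 1 subpaths. Giving each
-- subpath one centre at its median and every further centre a vertex of its own, the
-- superadditivity of s ↦ ⌊ s² / 4 ⌋ bounds the value of every feasible strategy by
-- ⌊ (m + 1 − B)² / 4 ⌋. The leaf strategy isolates B vertices, each of which must be a centre
-- for the cost to be finite; the one remaining centre serves the path on m + 1 − B vertices,
-- which costs exactly that bound.

module Submission where

open import Defs
open import Data.Nat using (ℕ; zero; suc; _+_; _∸_; _≤_; _<_; z≤n; s≤s; s≤s⁻¹; z<s; _≤?_; _<?_; _≟_; ∣_-_∣; ⌊_/2⌋)
open import Data.Nat.Properties
open import Data.Nat.Tactic.RingSolver using (solve-∀)
open import Data.Bool using (Bool; true; false; if_then_else_; _∨_)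
open import Data.Bool.Properties using (∨-conicalˡ; ∨-conicalʳ; ∨-zeroʳ)
open import Data.Fin using (Fin; zero; suc; toℕ; inject₁; fromℕ<)
open import Data.Fin.Properties using (toℕ-injective; toℕ-inject₁; toℕ<n; fromℕ<-toℕ; toℕ-fromℕ<)
  renaming (_≟_ to _≟ᶠ_)
open import Data.Fin.Subset using (Subset; ∣_∣)
open import Data.Vec using (lookup; []; _∷_)
import Data.Vec
open import Data.Vec.Properties using (lookup∘tabulate)
open import Data.List using (List; []; _∷_; foldr; map; allFin; tabulate)
open import Data.List.Properties using (map-tabulate; map-cong)
open import Data.List.Membership.Propositional using (_∈_)
open import Data.List.Membership.Propositional.Properties using (∈-allFin)
open import Data.List.Relation.Unary.Any using (here; there)
open import Data.Nat.ListAction using () renaming (sum to sumL)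
open import Function using (id; _∘_)
open import Data.Product using (Σ; _×_; _,_; proj₁; proj₂)
open import Data.Sum using (_⊎_; inj₁; inj₂; [_,_]′; swap)
open import Data.Empty using (⊥-elim)
open import Relation.Binary.PropositionalEquality
open import Relation.Nullary using (¬_; Dec; does; yes; no)
open import Relation.Nullary.Decidable using (dec-true; dec-false; _×-dec_)

false≢true : false ≢ true
false≢true ()

does-false : ∀ {A : Set} (a? : Dec A) → does a? ≡ false → ¬ A
does-false (yes a) ()
does-false (no ¬a) _ = ¬a

-- ⌊ s² / 4 ⌋: the least total distance from the s vertices of a path to one of them.
quarterSquare : ℕ → ℕ
quarterSquare 0 = 0
quarterSquare 1 = 0
quarterSquare (suc (suc s)) = quarterSquare s + suc s

quarterSquare-suc : ∀ s → quarterSquare (suc s) ≤ quarterSquare s + s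
quarterSquare-suc 0 = z≤n
quarterSquare-suc 1 = ≤-refl
quarterSquare-suc (suc (suc s)) = begin
  quarterSquare (suc s) + suc (suc s)  ≤⟨ +-monoˡ-≤ (suc (suc s)) (quarterSquare-suc s) ⟩
  quarterSquare s + s + suc (suc s)    ≡⟨ shuffle (quarterSquare s) s ⟩
  quarterSquare s + suc s + suc s      ≤⟨ +-monoʳ-≤ (quarterSquare s + suc s) (n≤1+n (suc s)) ⟩
  quarterSquare s + suc s + suc (suc s) ∎
  where
  open ≤-Reasoning
  shuffle : ∀ a b → a + b + suc (suc b) ≡ a + suc b + suc b
  shuffle = solve-∀

quarterSquare-superadditive : ∀ x y →
  quarterSquare (suc x) + quarterSquare (suc y) ≤ quarterSquare (suc (x + y))
quarterSquare-superadditive 0 y = ≤-refl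
quarterSquare-superadditive 1 y = begin
  suc (quarterSquare (suc y))  ≤⟨ s≤s (quarterSquare-suc y) ⟩
  suc (quarterSquare y + y)    ≡⟨ +-suc (quarterSquare y) y ⟨
  quarterSquare y + suc y      ∎
  where open ≤-Reasoning
quarterSquare-superadditive (suc (suc x)) y = begin
  quarterSquare (suc x) + suc (suc x) + quarterSquare (suc y)
    ≡⟨ shuffle (quarterSquare (suc x)) (suc (suc x)) (quarterSquare (suc y)) ⟩
  quarterSquare (suc x) + quarterSquare (suc y) + suc (suc x)
    ≤⟨ +-monoˡ-≤ (suc (suc x)) (quarterSquare-superadditive x y) ⟩
  quarterSquare (suc (x + y)) + suc (suc x)
    ≤⟨ +-monoʳ-≤ (quarterSquare (suc (x + y))) (s≤s (s≤s (m≤m+n x y))) ⟩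
  quarterSquare (suc (x + y)) + suc (suc (x + y)) ∎
  where
  open ≤-Reasoning
  shuffle : ∀ a b c → a + b + c ≡ a + c + b
  shuffle = solve-∀

rangeSum : (ℕ → ℕ) → ℕ → ℕ → ℕ
rangeSum ψ a zero = 0
rangeSum ψ a (suc l) = ψ a + rangeSum ψ (suc a) l

InRange : ℕ → ℕ → ℕ → Set
InRange a l v = a ≤ v × v < a + l

inRange-head : ∀ a l → InRange a (suc l) a
inRange-head a l = ≤-refl , m<m+n a z<s

inRange-tail : ∀ {a l v} → InRange (suc a) l v → InRange a (suc l) v
inRange-tail {a} {l} {v} (a<v , v<) = <⇒≤ a<v , subst (v <_) (sym (+-suc a l)) v<

inRange-untail : ∀ {a l v} → InRange a (suc l) v → a ≢ v → InRange (suc a) l v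
inRange-untail {a} {l} {v} (a≤v , v<) a≢v = ≤∧≢⇒< a≤v a≢v , subst (v <_) (+-suc a l) v<

inRange-empty : ∀ {a v} → ¬ InRange a 0 v
inRange-empty {a} {v} (a≤v , v<) = <-irrefl refl (≤-<-trans a≤v (subst (v <_) (+-identityʳ a) v<))

inRange-widenˡ : ∀ {a x y v} → InRange a x v → InRange a (x + y) v
inRange-widenˡ {a} {x} {y} (a≤v , v<) = a≤v , <-≤-trans v< (+-monoʳ-≤ a (m≤m+n x y))

inRange-widenʳ : ∀ {a x y v} → InRange (a + x) y v → InRange a (x + y) v
inRange-widenʳ {a} {x} {y} {v} (≤v , v<) = ≤-trans (m≤m+n a x) ≤v , subst (v <_) (+-assoc a x y) v<

inRange-split : ∀ {a x y v} → InRange a (x + y) v → InRange a x v ⊎ InRange (a + x) y v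
inRange-split {a} {x} {y} {v} (a≤v , v<) with v <? a + x
... | yes v<a+x = inj₁ (a≤v , v<a+x)
... | no v≮a+x = inj₂ (≮⇒≥ v≮a+x , subst (v <_) (sym (+-assoc a x y)) v<)

rangeSum-++ : ∀ ψ a x y → rangeSum ψ a (x + y) ≡ rangeSum ψ a x + rangeSum ψ (a + x) y
rangeSum-++ ψ a zero y rewrite +-identityʳ a = refl
rangeSum-++ ψ a (suc x) y rewrite rangeSum-++ ψ (suc a) x y | +-suc a x =
  sym (+-assoc (ψ a) _ _)

rangeSum-++₃ : ∀ ψ a x y z → rangeSum ψ a (x + (y + z)) ≡
  rangeSum ψ a x + (rangeSum ψ (a + x) y + rangeSum ψ (a + x + y) z)
rangeSum-++₃ ψ a x y z =
  trans (rangeSum-++ ψ a x (y + z)) (cong (rangeSum ψ a x +_) (rangeSum-++ ψ (a + x) y z))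

rangeSum-cong : ∀ {ψ φ} a l → (∀ v → InRange a l v → ψ v ≡ φ v) → rangeSum ψ a l ≡ rangeSum φ a l
rangeSum-cong a zero eq = refl
rangeSum-cong a (suc l) eq =
  cong₂ _+_ (eq a (inRange-head a l)) (rangeSum-cong (suc a) l (λ v r → eq v (inRange-tail r)))

rangeSum-++-cong : ∀ {ψ ψ₁ ψ₂} a x y →
  (∀ v → InRange a x v → ψ v ≡ ψ₁ v) → (∀ v → InRange (a + x) y v → ψ v ≡ ψ₂ v) →
  rangeSum ψ a (x + y) ≡ rangeSum ψ₁ a x + rangeSum ψ₂ (a + x) y
rangeSum-++-cong {ψ} a x y eq₁ eq₂ =
  trans (rangeSum-++ ψ a x y) (cong₂ _+_ (rangeSum-cong a x eq₁) (rangeSum-cong (a + x) y eq₂))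

rangeSum-suc : ∀ ψ a l → rangeSum (λ v → ψ (suc v)) a l ≡ rangeSum ψ (suc a) l
rangeSum-suc ψ a zero = refl
rangeSum-suc ψ a (suc l) = cong (ψ (suc a) +_) (rangeSum-suc ψ (suc a) l)

rangeSum-ends : ∀ ψ a l →
  rangeSum ψ a (suc (suc l)) ≡ rangeSum ψ (suc a) l + (ψ a + ψ (suc a + l))
rangeSum-ends ψ a l = begin
  ψ a + rangeSum ψ (suc a) (suc l)                ≡⟨ cong (λ n → ψ a + rangeSum ψ (suc a) n) (+-comm 1 l) ⟩
  ψ a + rangeSum ψ (suc a) (l + 1)                ≡⟨ cong (ψ a +_) (rangeSum-++ ψ (suc a) l 1) ⟩
  ψ a + (rangeSum ψ (suc a) l + (ψ (suc a + l) + 0)) ≡⟨ shuffle (ψ a) (rangeSum ψ (suc a) l) (ψ (suc a + l)) ⟩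
  rangeSum ψ (suc a) l + (ψ a + ψ (suc a + l))    ∎
  where
  open ≡-Reasoning
  shuffle : ∀ p q r → p + (q + (r + 0)) ≡ q + (p + r)
  shuffle = solve-∀

indicator : Bool → ℕ
indicator b = if b then 1 else 0

count : (ℕ → Bool) → ℕ → ℕ → ℕ
count P = rangeSum (λ v → indicator (P v))

count-≤ : ∀ P a l → count P a l ≤ l
count-≤ P a zero = z≤n
count-≤ P a (suc l) with P a
... | true = s≤s (count-≤ P (suc a) l)
... | false = m≤n⇒m≤1+n (count-≤ P (suc a) l)

count-allTrue : ∀ P a l → (∀ v → InRange a l v → P v ≡ true) → count P a l ≡ l
count-allTrue P a zero _ = refl
count-allTrue P a (suc l) all rewrite all a (inRange-head a l) =
  cong suc (count-allTrue P (suc a) l (λ v r → all v (inRange-tail r)))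

count-allFalse : ∀ P a l → (∀ v → InRange a l v → P v ≡ false) → count P a l ≡ 0
count-allFalse P a zero _ = refl
count-allFalse P a (suc l) none rewrite none a (inRange-head a l) =
  count-allFalse P (suc a) l (λ v r → none v (inRange-tail r))

count≡0⇒false : ∀ P a l → count P a l ≡ 0 → ∀ v → InRange a l v → P v ≡ false
count≡0⇒false P a zero _ v r = ⊥-elim (inRange-empty r)
count≡0⇒false P a (suc l) none v r with P a in Pa
... | false with a ≟ v
...   | yes refl = Pa
...   | no a≢v = count≡0⇒false P (suc a) l none v (inRange-untail r a≢v)

count≡1⇒unique : ∀ P a l → count P a l ≡ 1 →
  Σ ℕ λ c → InRange a l c × P c ≡ true × (∀ v → InRange a l v → P v ≡ true → v ≡ c)
count≡1⇒unique P a (suc l) one with P a in Pa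
... | true = a , inRange-head a l , Pa , only-a
  where
  only-a : ∀ v → InRange a (suc l) v → P v ≡ true → v ≡ a
  only-a v r Pv with a ≟ v
  ... | yes a≡v = sym a≡v
  ... | no a≢v with trans (sym Pv) (count≡0⇒false P (suc a) l (suc-injective one) v (inRange-untail r a≢v))
  ...   | ()
... | false with count≡1⇒unique P (suc a) l one
...   | c , r , Pc , only-c = c , inRange-tail r , Pc , only-c′
  where
  only-c′ : ∀ v → InRange a (suc l) v → P v ≡ true → v ≡ c
  only-c′ v r′ Pv with a ≟ v
  ... | yes refl with trans (sym Pv) Pa
  ...   | ()
  only-c′ v r′ Pv | no a≢v = only-c v (inRange-untail r′ a≢v) Pv

count-≟ : ∀ c a l → InRange a l c → count (λ v → does (v ≟ c)) a l ≡ 1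
count-≟ c a zero r = ⊥-elim (inRange-empty r)
count-≟ c a (suc l) r with a ≟ c
... | yes refl = cong₂ _+_ (cong indicator (dec-true (a ≟ a) refl)) (count-allFalse _ (suc a) l
                   (λ v (a<v , _) → dec-false (v ≟ a) (λ v≡a → <-irrefl (sym v≡a) a<v)))
... | no a≢c = trans (cong (λ b → indicator b + count (λ v → does (v ≟ c)) (suc a) l) (dec-false (a ≟ c) a≢c))
                     (count-≟ c (suc a) l (inRange-untail r a≢c))

first-true : ∀ P a l → 1 ≤ count P a l →
  Σ ℕ λ l₁ → l₁ < l × count P a l₁ ≡ 0 × P (a + l₁) ≡ true
first-true P a (suc l) some with P a in Pa
... | true = 0 , z<s , refl , trans (cong P (+-identityʳ a)) Pa
... | false with first-true P (suc a) l some
...   | l₁ , l₁<l , none , P[a+1+l₁] =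
        suc l₁ , s≤s l₁<l , trans (cong (λ b → indicator b + count P (suc a) l₁) Pa) none ,
        trans (cong P (+-suc a l₁)) P[a+1+l₁]

split-at-first-true : ∀ P c s a → count P a (suc (c + s)) ≡ suc c →
  Σ ℕ λ l₁ → Σ ℕ λ s₂ → l₁ + s₂ ≡ s × count P a l₁ ≡ 0 × count P (suc (a + l₁)) (c + s₂) ≡ c
split-at-first-true P c s a total
  with first-true P a (suc (c + s)) (subst (1 ≤_) (sym total) (s≤s z≤n))
... | l₁ , l₁< , none , P[a+l₁] with m≤n⇒∃[o]m+o≡n (s≤s⁻¹ l₁<)
...   | r , l₁+r≡c+s = split (m≤n⇒∃[o]m+o≡n (subst (_≤ r) rest (count-≤ P (suc (a + l₁)) r)))
  where
  rest : count P (suc (a + l₁)) r ≡ c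
  rest = suc-injective (begin
    suc (count P (suc (a + l₁)) r)           ≡⟨ cong (λ b → indicator b + count P (suc (a + l₁)) r) P[a+l₁] ⟨
    count P (a + l₁) (suc r)                 ≡⟨ cong (_+ count P (a + l₁) (suc r)) none ⟨
    count P a l₁ + count P (a + l₁) (suc r)  ≡⟨ rangeSum-++ _ a l₁ (suc r) ⟨
    count P a (l₁ + suc r)                   ≡⟨ cong (count P a) (trans (+-suc l₁ r) (cong suc l₁+r≡c+s)) ⟩
    count P a (suc (c + s))                  ≡⟨ total ⟩
    suc c                                    ∎)
    where open ≡-Reasoning
  shuffle : ∀ x y z → y + (x + z) ≡ x + (y + z)
  shuffle = solve-∀
  split : (Σ ℕ λ s₂ → c + s₂ ≡ r) →
    Σ ℕ λ l₁ → Σ ℕ λ s₂ → l₁ + s₂ ≡ s × count P a l₁ ≡ 0 × count P (suc (a + l₁)) (c + s₂) ≡ c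
  split (s₂ , c+s₂≡r) =
    l₁ , s₂ , +-cancelˡ-≡ c _ _ (trans (shuffle l₁ c s₂) (trans (cong (l₁ +_) c+s₂≡r) l₁+r≡c+s)) ,
    none , trans (cong (count P (suc (a + l₁))) c+s₂≡r) rest

all-or-counterexample : ∀ (P : ℕ → Bool) a l →
  (∀ v → InRange a l v → P v ≡ true) ⊎ (Σ ℕ λ v → InRange a l v × P v ≡ false)
all-or-counterexample P a zero = inj₁ (λ v r → ⊥-elim (inRange-empty r))
all-or-counterexample P a (suc l) with P a in Pa
... | false = inj₂ (a , inRange-head a l , Pa)
... | true with all-or-counterexample P (suc a) l
...   | inj₂ (v , r , Pv) = inj₂ (v , inRange-tail r , Pv)
...   | inj₁ all = inj₁ all′
  where
  all′ : ∀ v → InRange a (suc l) v → P v ≡ true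
  all′ v r with a ≟ v
  ... | yes refl = Pa
  ... | no a≢v = all v (inRange-untail r a≢v)

∣-∣-between : ∀ {a b c} → a ≤ c → c ≤ b → ∣ a - c ∣ + ∣ c - b ∣ ≡ ∣ a - b ∣
∣-∣-between {a} a≤c c≤b with m≤n⇒∃[o]m+o≡n a≤c
... | x , refl with m≤n⇒∃[o]m+o≡n c≤b
...   | y , refl = begin
  ∣ a - a + x ∣ + ∣ a + x - a + x + y ∣  ≡⟨ cong₂ _+_ (∣m-m+n∣≡n a x) (∣m-m+n∣≡n (a + x) y) ⟩
  x + y                                  ≡⟨ ∣m-m+n∣≡n a (x + y) ⟨
  ∣ a - a + (x + y) ∣                    ≡⟨ cong (λ b → ∣ a - b ∣) (+-assoc a x y) ⟨
  ∣ a - a + x + y ∣                      ∎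
  where open ≡-Reasoning

∣a-[1+a+L]∣ : ∀ a L → ∣ a - suc a + L ∣ ≡ suc L
∣a-[1+a+L]∣ a L = trans (cong (λ b → ∣ a - b ∣) (sym (+-suc a L))) (∣m-m+n∣≡n a (suc L))

ends-distance-≥ : ∀ a L c → suc L ≤ ∣ a - c ∣ + ∣ suc a + L - c ∣
ends-distance-≥ a L c = begin
  suc L                          ≡⟨ ∣a-[1+a+L]∣ a L ⟨
  ∣ a - suc a + L ∣              ≤⟨ ∣-∣-triangle a c (suc a + L) ⟩
  ∣ a - c ∣ + ∣ c - suc a + L ∣  ≡⟨ cong (∣ a - c ∣ +_) (∣-∣-comm c (suc a + L)) ⟩
  ∣ a - c ∣ + ∣ suc a + L - c ∣  ∎
  where open ≤-Reasoning

ends-distance-between : ∀ a L c → a ≤ c → c ≤ suc a + L → ∣ a - c ∣ + ∣ suc a + L - c ∣ ≡ suc L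
ends-distance-between a L c a≤c c≤ = begin
  ∣ a - c ∣ + ∣ suc a + L - c ∣  ≡⟨ cong (∣ a - c ∣ +_) (∣-∣-comm (suc a + L) c) ⟩
  ∣ a - c ∣ + ∣ c - suc a + L ∣  ≡⟨ ∣-∣-between a≤c c≤ ⟩
  ∣ a - suc a + L ∣              ≡⟨ ∣a-[1+a+L]∣ a L ⟩
  suc L                          ∎
  where open ≡-Reasoning

quarterSquare-≤-rangeSum : ∀ L a c → quarterSquare L ≤ rangeSum (λ v → ∣ v - c ∣) a L
quarterSquare-≤-rangeSum 0 a c = z≤n
quarterSquare-≤-rangeSum 1 a c = z≤n
quarterSquare-≤-rangeSum (suc (suc L)) a c = begin
  quarterSquare L + suc L
    ≤⟨ +-mono-≤ (quarterSquare-≤-rangeSum L (suc a) c) (ends-distance-≥ a L c) ⟩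
  rangeSum ψ (suc a) L + (∣ a - c ∣ + ∣ suc a + L - c ∣)  ≡⟨ rangeSum-ends ψ a L ⟨
  rangeSum ψ a (suc (suc L))                              ∎
  where
  open ≤-Reasoning
  ψ = λ v → ∣ v - c ∣

rangeSum-median-≤ : ∀ L a c → c ≡ a + ⌊ L /2⌋ → rangeSum (λ v → ∣ v - c ∣) a L ≤ quarterSquare L
rangeSum-median-≤ 0 a c _ = z≤n
rangeSum-median-≤ 1 a c refl = ≤-reflexive (trans (+-identityʳ _) (m≡n⇒∣m-n∣≡0 (sym (+-identityʳ a))))
rangeSum-median-≤ (suc (suc L)) a c refl = begin
  rangeSum ψ a (suc (suc L))                              ≡⟨ rangeSum-ends ψ a L ⟩
  rangeSum ψ (suc a) L + (∣ a - c ∣ + ∣ suc a + L - c ∣)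
    ≤⟨ +-monoˡ-≤ _ (rangeSum-median-≤ L (suc a) c (+-suc a ⌊ L /2⌋)) ⟩
  quarterSquare L + (∣ a - c ∣ + ∣ suc a + L - c ∣)       ≡⟨ cong (quarterSquare L +_) (ends-distance-between a L c a≤c c≤) ⟩
  quarterSquare L + suc L                                 ∎
  where
  open ≤-Reasoning
  ψ = λ v → ∣ v - c ∣
  a≤c : a ≤ c
  a≤c = m≤m+n a _
  c≤ : c ≤ suc a + L
  c≤ = subst (c ≤_) (+-suc a L) (+-monoʳ-≤ a (s≤s (⌊n/2⌋≤n L)))

-- Placing centres on a path whose edges j with cut j ≡ true are removed

Uncut : (ℕ → Bool) → ℕ → ℕ → Set
Uncut cut x y = ∀ j → x ≤ j → j < y → cut j ≡ false

Linked : (ℕ → Bool) → ℕ → ℕ → Set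
Linked cut x y = Uncut cut x y × Uncut cut y x

record Placement (cut : ℕ → Bool) (a n k C : ℕ) : Set where
  field
    centre         : ℕ → Bool
    assign         : ℕ → ℕ
    centre-count   : count centre a n ≡ k
    assign-centre  : ∀ v → InRange a n v → centre (assign v) ≡ true
    assign-inRange : ∀ v → InRange a n v → InRange a n (assign v)
    assign-linked  : ∀ v → InRange a n v → Linked cut v (assign v)
    assign-cost    : rangeSum (λ v → ∣ v - assign v ∣) a n ≤ C

splice : {A : Set} → ℕ → (ℕ → A) → (ℕ → A) → ℕ → A
splice b f g v = if does (v <? b) then f v else g v

splice-< : ∀ {A : Set} {b v} (f g : ℕ → A) → v < b → splice b f g v ≡ f v
splice-< {b = b} {v} f g v<b = cong (if_then f v else g v) (dec-true (v <? b) v<b)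

splice-≥ : ∀ {A : Set} {b v} (f g : ℕ → A) → b ≤ v → splice b f g v ≡ g v
splice-≥ {b = b} {v} f g b≤v = cong (if_then f v else g v) (dec-false (v <? b) (≤⇒≯ b≤v))

module _ {cut : ℕ → Bool} where

  resize : ∀ {a n n′ k C C′} → n ≡ n′ → C ≤ C′ → Placement cut a n k C → Placement cut a n′ k C′
  resize refl C≤C′ p = record
    { Placement p hiding (assign-cost) ; assign-cost = ≤-trans (Placement.assign-cost p) C≤C′ }

  glue : ∀ {a b n₁ n₂ k₁ k₂ C₁ C₂} → a + n₁ ≡ b →
    Placement cut a n₁ k₁ C₁ → Placement cut b n₂ k₂ C₂ → Placement cut a (n₁ + n₂) (k₁ + k₂) (C₁ + C₂)
  glue {a} {b} {n₁} {n₂} refl p₁ p₂ = record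
    { centre         = centre
    ; assign         = assign
    ; centre-count   = trans
        (rangeSum-++-cong a n₁ n₂ (λ v r → cong indicator (on₁ P₁.centre P₂.centre r))
                                  (λ v r → cong indicator (on₂ P₁.centre P₂.centre r)))
        (cong₂ _+_ P₁.centre-count P₂.centre-count)
    ; assign-centre  = λ v → [ (λ r → trans (cong centre (on₁ P₁.assign P₂.assign r))
                                 (trans (on₁ P₁.centre P₂.centre (P₁.assign-inRange v r)) (P₁.assign-centre v r)))
                             , (λ r → trans (cong centre (on₂ P₁.assign P₂.assign r))
                                 (trans (on₂ P₁.centre P₂.centre (P₂.assign-inRange v r)) (P₂.assign-centre v r)))
                             ]′ ∘ inRange-split
    ; assign-inRange = λ v → [ (λ r → subst (InRange a (n₁ + n₂)) (sym (on₁ P₁.assign P₂.assign r))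
                                        (inRange-widenˡ (P₁.assign-inRange v r)))
                             , (λ r → subst (InRange a (n₁ + n₂)) (sym (on₂ P₁.assign P₂.assign r))
                                        (inRange-widenʳ (P₂.assign-inRange v r)))
                             ]′ ∘ inRange-split
    ; assign-linked  = λ v → [ (λ r → subst (Linked cut v) (sym (on₁ P₁.assign P₂.assign r)) (P₁.assign-linked v r))
                             , (λ r → subst (Linked cut v) (sym (on₂ P₁.assign P₂.assign r)) (P₂.assign-linked v r))
                             ]′ ∘ inRange-split
    ; assign-cost    = ≤-trans
        (≤-reflexive (rangeSum-++-cong a n₁ n₂ (λ v r → cong (λ u → ∣ v - u ∣) (on₁ P₁.assign P₂.assign r))
                                               (λ v r → cong (λ u → ∣ v - u ∣) (on₂ P₁.assign P₂.assign r))))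
        (+-mono-≤ P₁.assign-cost P₂.assign-cost)
    }
    where
    module P₁ = Placement p₁
    module P₂ = Placement p₂
    centre = splice (a + n₁) P₁.centre P₂.centre
    assign = splice (a + n₁) P₁.assign P₂.assign
    on₁ : ∀ {A : Set} (f g : ℕ → A) {v} → InRange a n₁ v → splice (a + n₁) f g v ≡ f v
    on₁ f g r = splice-< f g (proj₂ r)
    on₂ : ∀ {A : Set} (f g : ℕ → A) {v} → InRange (a + n₁) n₂ v → splice (a + n₁) f g v ≡ g v
    on₂ f g r = splice-≥ f g (proj₁ r)

inRange-last : ∀ {a s v} → InRange a (suc s) v → v ≤ a + s
inRange-last {a} {s} {v} (_ , v<) = s≤s⁻¹ (subst (v <_) (+-suc a s) v<)

module _ (cut : ℕ → Bool) where

  segment : ∀ a s → count cut a s ≡ 0 → Placement cut a (suc s) 1 (quarterSquare (suc s))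
  segment a s none = record
    { centre         = λ v → does (v ≟ c)
    ; assign         = λ _ → c
    ; centre-count   = count-≟ c a (suc s) c∈
    ; assign-centre  = λ _ _ → dec-true (c ≟ c) refl
    ; assign-inRange = λ _ _ → c∈
    ; assign-linked  = λ v r → uncut (proj₁ r) (inRange-last c∈) , uncut (proj₁ c∈) (inRange-last r)
    ; assign-cost    = rangeSum-median-≤ (suc s) a c refl
    }
    where
    c = a + ⌊ suc s /2⌋
    c∈ : InRange a (suc s) c
    c∈ = m≤m+n a _ , +-monoʳ-< a (⌊n/2⌋<n s)
    uncut : ∀ {x y} → a ≤ x → y ≤ a + s → Uncut cut x y
    uncut a≤x y≤ j x≤j j<y = count≡0⇒false cut a s none j (≤-trans a≤x x≤j , <-≤-trans j<y y≤)

  -- Induction on the number c of centres beyond the first: a spare centre goes on the first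
  -- vertex; otherwise there are exactly c cuts and the path splits at the first one.
  placement : ∀ c s a → count cut a (c + s) ≤ c →
    Placement cut a (suc (c + s)) (suc c) (quarterSquare (suc s))
  placement zero s a none = segment a s (n≤0⇒n≡0 none)
  placement (suc c) s a cuts with count cut a (suc c + s) ≤? c
  ... | yes ≤c = glue (+-comm a 1) (segment a 0 refl)
                   (placement c s (suc a) (≤-trans (m≤n+m _ (indicator (cut a))) ≤c))
  ... | no ≰c with split-at-first-true cut c s a (≤-antisym cuts (≰⇒> ≰c))
  ...   | l₁ , s₂ , l₁+s₂≡s , none , rest =
    resize (cong suc (trans (shuffle l₁ c s₂) (cong (λ x → suc (c + x)) l₁+s₂≡s)))
           (subst (λ x → _ ≤ quarterSquare (suc x)) l₁+s₂≡s (quarterSquare-superadditive l₁ s₂))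
           (glue (+-suc a l₁) (segment a l₁ none) (placement c s₂ (suc (a + l₁)) (≤-reflexive rest)))
    where
    shuffle : ∀ x y z → x + suc (y + z) ≡ suc (y + (x + z))
    shuffle = solve-∀

Joins-sym : ∀ {G e u w} → Joins G e u w → Joins G e w u
Joins-sym {G} {e} J with ends G e
... | _ , _ = swap J

module _ {G : Graph} {γ : Strategy G} where

  walk-snoc : ∀ {u w v d} e → γ e ≡ false → Joins G e w v →
    Walk G one γ u w d → Walk G one γ u v (d + 1)
  walk-snoc e uncut J nil = step e uncut J nil
  walk-snoc e uncut J (step e′ uncut′ J′ walk) = step e′ uncut′ J′ (walk-snoc e uncut J walk)

  walk-reverse : ∀ {u v d} → Walk G one γ u v d → Walk G one γ v u d
  walk-reverse nil = nil
  walk-reverse {d = suc d} (step e uncut J walk) =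
    subst (Walk G one γ _ _) (+-comm d 1) (walk-snoc e uncut (Joins-sym {G} {e} J) (walk-reverse walk))

∣n-1+n∣≡1 : ∀ n → ∣ n - suc n ∣ ≡ 1
∣n-1+n∣≡1 zero = refl
∣n-1+n∣≡1 (suc n) = ∣n-1+n∣≡1 n

module PathWalks {m : ℕ} (γ : Strategy (PathGraph m)) where

  PathWalk : Fin (suc m) → Fin (suc m) → ℕ → Set
  PathWalk = Walk (PathGraph m) one γ

  joins-endpoint : ∀ {e u w} → Joins (PathGraph m) e u w → toℕ u ≡ toℕ e ⊎ toℕ u ≡ suc (toℕ e)
  joins-endpoint {e} (inj₁ (refl , refl)) = inj₁ (toℕ-inject₁ e)
  joins-endpoint (inj₂ (refl , refl)) = inj₂ refl

  edge-length : ∀ {e u w} → Joins (PathGraph m) e u w → ∣ toℕ u - toℕ w ∣ ≡ 1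
  edge-length {e} (inj₁ (refl , refl)) =
    trans (cong (λ x → ∣ x - suc (toℕ e) ∣) (toℕ-inject₁ e)) (∣n-1+n∣≡1 (toℕ e))
  edge-length {e} (inj₂ (refl , refl)) =
    trans (cong (λ x → ∣ suc (toℕ e) - x ∣) (toℕ-inject₁ e))
          (trans (∣-∣-comm (suc (toℕ e)) (toℕ e)) (∣n-1+n∣≡1 (toℕ e)))

  walk-length-≥ : ∀ {u v d} → PathWalk u v d → ∣ toℕ u - toℕ v ∣ ≤ d
  walk-length-≥ {u} nil = ≤-reflexive (∣n-n∣≡0 (toℕ u))
  walk-length-≥ {u} {v} (step {w = w} e _ J walk) =
    ≤-trans (∣-∣-triangle (toℕ u) (toℕ w) (toℕ v))
            (+-mono-≤ (≤-reflexive (edge-length J)) (walk-length-≥ walk))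

  walk-confined : ∀ (R : ℕ → Set) → (∀ e → γ e ≡ false → R (toℕ e) × R (suc (toℕ e))) →
    ∀ {u v d} → PathWalk u v d → u ≡ v ⊎ (R (toℕ u) × R (toℕ v))
  walk-confined R closed nil = inj₁ refl
  walk-confined R closed {v = v} (step {w = w} e uncut J walk) =
    inj₂ (at-end (joins-endpoint J) , at-v (walk-confined R closed walk))
    where
    at-end : ∀ {x} → toℕ x ≡ toℕ e ⊎ toℕ x ≡ suc (toℕ e) → R (toℕ x)
    at-end (inj₁ x≡e) = subst R (sym x≡e) (proj₁ (closed e uncut))
    at-end (inj₂ x≡1+e) = subst R (sym x≡1+e) (proj₂ (closed e uncut))
    at-v : w ≡ v ⊎ (R (toℕ w) × R (toℕ v)) → R (toℕ v)
    at-v (inj₁ refl) = at-end (joins-endpoint (Joins-sym {PathGraph m} {e} J))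
    at-v (inj₂ (_ , Rv)) = Rv

  descending-walk : ∀ k (u v : Fin (suc m)) → toℕ u ≡ toℕ v + k →
    (∀ j → toℕ v ≤ toℕ j → toℕ j < toℕ u → γ j ≡ false) → PathWalk u v k
  descending-walk zero u v u≡v+0 _ with toℕ-injective (trans u≡v+0 (+-identityʳ (toℕ v)))
  ... | refl = nil
  descending-walk (suc k) zero v 0≡v+1+k _ with trans 0≡v+1+k (+-suc (toℕ v) k)
  ... | ()
  descending-walk (suc k) (suc j) v 1+j≡v+1+k uncut =
    step j (uncut j v≤j ≤-refl) (inj₂ (refl , refl))
      (descending-walk k (inject₁ j) v (trans (toℕ-inject₁ j) j≡v+k)
        (λ j′ v≤j′ j′<j → uncut j′ v≤j′ (m<n⇒m<1+n (subst (toℕ j′ <_) (toℕ-inject₁ j) j′<j))))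
    where
    j≡v+k : toℕ j ≡ toℕ v + k
    j≡v+k = suc-injective (trans 1+j≡v+1+k (+-suc (toℕ v) k))
    v≤j : toℕ v ≤ toℕ j
    v≤j = subst (toℕ v ≤_) (sym j≡v+k) (m≤m+n (toℕ v) k)

  module _ (cut : ℕ → Bool) (cut-toℕ : ∀ j → cut (toℕ j) ≡ γ j) where

    uncut : ∀ {x y} → Uncut cut x y → ∀ j → x ≤ toℕ j → toℕ j < y → γ j ≡ false
    uncut U j x≤j j<y = trans (sym (cut-toℕ j)) (U (toℕ j) x≤j j<y)

    linked-walk : ∀ u v → Linked cut (toℕ u) (toℕ v) → PathWalk u v ∣ toℕ u - toℕ v ∣
    linked-walk u v (up , down) with toℕ v ≤? toℕ u
    ... | yes v≤u = subst (PathWalk u v) (sym (m≤n⇒∣n-m∣≡n∸m v≤u))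
          (descending-walk _ u v (sym (m+[n∸m]≡n v≤u)) (λ j → uncut down j))
    ... | no v≰u = subst (PathWalk u v) (sym (m≤n⇒∣m-n∣≡n∸m u≤v))
          (walk-reverse (descending-walk _ v u (sym (m+[n∸m]≡n u≤v)) (λ j → uncut up j)))
      where u≤v = ≰⇒≥ v≰u

≤∞-refl : ∀ {x} → x ≤∞ x
≤∞-refl {fin x} = fin≤fin ≤-refl
≤∞-refl {∞} = x≤∞

≤∞-trans : ∀ {x y z} → x ≤∞ y → y ≤∞ z → x ≤∞ z
≤∞-trans (fin≤fin x≤y) (fin≤fin y≤z) = fin≤fin (≤-trans x≤y y≤z)
≤∞-trans _ x≤∞ = x≤∞

≤∞-antisym : ∀ {x y} → x ≤∞ y → y ≤∞ x → x ≡ y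
≤∞-antisym (fin≤fin x≤y) (fin≤fin y≤x) = cong fin (≤-antisym x≤y y≤x)
≤∞-antisym x≤∞ x≤∞ = refl

0≤∞ : ∀ x → fin 0 ≤∞ x
0≤∞ (fin x) = fin≤fin z≤n
0≤∞ ∞ = x≤∞

x+∞∞≡∞ : ∀ x → x +∞ ∞ ≡ ∞
x+∞∞≡∞ (fin x) = refl
x+∞∞≡∞ ∞ = refl

+∞-mono-≤∞ : ∀ {x x′ y y′} → x ≤∞ x′ → y ≤∞ y′ → (x +∞ y) ≤∞ (x′ +∞ y′)
+∞-mono-≤∞ (fin≤fin x≤x′) (fin≤fin y≤y′) = fin≤fin (+-mono-≤ x≤x′ y≤y′)
+∞-mono-≤∞ {x′ = x′} _ x≤∞ = subst (_ ≤∞_) (sym (x+∞∞≡∞ x′)) x≤∞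
+∞-mono-≤∞ x≤∞ (fin≤fin _) = x≤∞

⊓∞-≤ˡ : ∀ x y → (x ⊓∞ y) ≤∞ x
⊓∞-≤ˡ (fin x) (fin y) = fin≤fin (m⊓n≤m x y)
⊓∞-≤ˡ (fin x) ∞ = ≤∞-refl
⊓∞-≤ˡ ∞ y = x≤∞

⊓∞-≤ʳ : ∀ x y → (x ⊓∞ y) ≤∞ y
⊓∞-≤ʳ (fin x) (fin y) = fin≤fin (m⊓n≤n x y)
⊓∞-≤ʳ (fin x) ∞ = x≤∞
⊓∞-≤ʳ ∞ y = ≤∞-refl

⊓∞-glb : ∀ {x y z} → z ≤∞ x → z ≤∞ y → z ≤∞ (x ⊓∞ y)
⊓∞-glb (fin≤fin z≤x) (fin≤fin z≤y) = fin≤fin (⊓-glb z≤x z≤y)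
⊓∞-glb {fin x} z≤x x≤∞ = z≤x
⊓∞-glb {∞} _ z≤y = z≤y

module _ {A : Set} where

  sum∞-mono : ∀ (xs : List A) {g h : A → ℕ∞} → (∀ x → g x ≤∞ h x) →
    sum∞ (map g xs) ≤∞ sum∞ (map h xs)
  sum∞-mono [] _ = ≤∞-refl
  sum∞-mono (x ∷ xs) g≤h = +∞-mono-≤∞ (g≤h x) (sum∞-mono xs g≤h)

  sum∞-fin : ∀ (xs : List A) (c : A → ℕ) → sum∞ (map (λ x → fin (c x)) xs) ≡ fin (sumL (map c xs))
  sum∞-fin [] c = refl
  sum∞-fin (x ∷ xs) c rewrite sum∞-fin xs c = refl

  sum∞-∞ : ∀ {xs : List A} {x} (g : A → ℕ∞) → x ∈ xs → g x ≡ ∞ → sum∞ (map g xs) ≡ ∞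
  sum∞-∞ {y ∷ xs} g (here refl) gx≡∞ rewrite gx≡∞ = refl
  sum∞-∞ {y ∷ xs} g (there x∈xs) gx≡∞ rewrite sum∞-∞ g x∈xs gx≡∞ = x+∞∞≡∞ (g y)

module _ {k : ℕ} (D : Fin k → Fin k → ℕ∞) (X : Subset k) (v : Fin k) where

  private
    nearer : Fin k → ℕ∞ → ℕ∞
    nearer x acc = if lookup X x then D v x ⊓∞ acc else acc

    foldr-≤ : ∀ {xs y} → y ∈ xs → lookup X y ≡ true → foldr nearer ∞ xs ≤∞ D v y
    foldr-≤ {y ∷ xs} (here refl) y∈X rewrite y∈X = ⊓∞-≤ˡ (D v y) _
    foldr-≤ {x ∷ xs} (there y∈xs) y∈X with lookup X x
    ... | true = ≤∞-trans (⊓∞-≤ʳ (D v x) _) (foldr-≤ y∈xs y∈X)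
    ... | false = foldr-≤ y∈xs y∈X

    ≤-foldr : ∀ xs {z} → (∀ y → lookup X y ≡ true → z ≤∞ D v y) → z ≤∞ foldr nearer ∞ xs
    ≤-foldr [] _ = x≤∞
    ≤-foldr (x ∷ xs) z≤D with lookup X x in x∈X
    ... | true = ⊓∞-glb (z≤D x x∈X) (≤-foldr xs z≤D)
    ... | false = ≤-foldr xs z≤D

  distToSet-≤ : ∀ {y} → lookup X y ≡ true → distToSet D X v ≤∞ D v y
  distToSet-≤ {y} = foldr-≤ (∈-allFin y)

  ≤-distToSet : ∀ {z} → (∀ y → lookup X y ≡ true → z ≤∞ D v y) → z ≤∞ distToSet D X v
  ≤-distToSet = ≤-foldr (allFin k)

dist-≤-walk : ∀ {G ℓ γ u v d k} → IsDist G ℓ γ u v d → Walk G ℓ γ u v k → d ≤∞ fin k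
dist-≤-walk {d = fin d} {k} (_ , shortest) walk = fin≤fin (shortest k walk)
dist-≤-walk {d = ∞} {k} unreachable walk = ⊥-elim (unreachable k walk)

sumL-allFin : ∀ n (ψ : ℕ → ℕ) → sumL (map (λ i → ψ (toℕ i)) (allFin n)) ≡ rangeSum ψ 0 n
sumL-allFin zero ψ = refl
sumL-allFin (suc n) ψ = cong (ψ 0 +_) (begin
  sumL (map (λ i → ψ (toℕ i)) (tabulate {n = n} suc))     ≡⟨ cong sumL (map-tabulate {n = n} suc (λ i → ψ (toℕ i))) ⟩
  sumL (tabulate {n = n} (λ i → ψ (suc (toℕ i))))         ≡⟨ cong sumL (map-tabulate {n = n} id (λ i → ψ (suc (toℕ i)))) ⟨
  sumL (map (λ i → ψ (suc (toℕ i))) (allFin n))           ≡⟨ sumL-allFin n (λ v → ψ (suc v)) ⟩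
  rangeSum (λ v → ψ (suc v)) 0 n                          ≡⟨ rangeSum-suc ψ 0 n ⟩
  rangeSum ψ 1 n                                          ∎)
  where open ≡-Reasoning

∣∷∣ : ∀ {n} x (X : Subset n) → ∣ x ∷ X ∣ ≡ indicator x + ∣ X ∣
∣∷∣ true X = refl
∣∷∣ false X = refl

∣∣≡count : ∀ {n} (P : ℕ → Bool) (X : Subset n) → (∀ i → lookup X i ≡ P (toℕ i)) → ∣ X ∣ ≡ count P 0 n
∣∣≡count P [] _ = refl
∣∣≡count {suc n} P (x ∷ X) X≡P = begin
  ∣ x ∷ X ∣                                   ≡⟨ ∣∷∣ x X ⟩
  indicator x + ∣ X ∣                         ≡⟨ cong₂ _+_ (cong indicator (X≡P zero))
                                                   (∣∣≡count (λ v → P (suc v)) X (λ i → X≡P (suc i))) ⟩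
  indicator (P 0) + count (λ v → P (suc v)) 0 n ≡⟨ cong (indicator (P 0) +_) (rangeSum-suc _ 0 n) ⟩
  count P 0 (suc n)                           ∎
  where open ≡-Reasoning

onℕ : ∀ {n} → (Fin n → Bool) → ℕ → Bool
onℕ {n} f j with j <? n
... | yes j<n = f (fromℕ< j<n)
... | no _ = false

onℕ-toℕ : ∀ {n} (f : Fin n → Bool) i → onℕ f (toℕ i) ≡ f i
onℕ-toℕ {n} f i with toℕ i <? n
... | yes i<n = cong f (fromℕ<-toℕ i i<n)
... | no i≮n = ⊥-elim (i≮n (toℕ<n i))

interdictionCost≡count : ∀ {m} (γ : Strategy (PathGraph m)) (cut : ℕ → Bool) →
  (∀ j → cut (toℕ j) ≡ γ j) → interdictionCost (PathGraph m) one γ ≡ count cut 0 m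
interdictionCost≡count {m} γ cut cut-toℕ =
  trans (cong sumL (map-cong (λ e → cong indicator (sym (cut-toℕ e))) (allFin m)))
        (sumL-allFin m (λ v → indicator (cut v)))

-- Upper bound on the value of any feasible strategy

module _ {m} (γ : Strategy (PathGraph m)) (cut : ℕ → Bool) (cut-toℕ : ∀ j → cut (toℕ j) ≡ γ j)
         (D : Fin (suc m) → Fin (suc m) → ℕ∞)
         (isDist : ∀ u v → IsDist (PathGraph m) one γ u v (D u v)) where

  open PathWalks γ

  placement-medianCost : ∀ {k C} → Placement cut 0 (suc m) k C →
    Σ (Subset (suc m)) λ X → ∣ X ∣ ≡ k × medianCost D X ≤∞ fin C
  placement-medianCost {k} {C} p = X , ∣X∣≡k , cost
    where
    open Placement p
    X : Subset (suc m)
    X = Data.Vec.tabulate (λ i → centre (toℕ i))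
    ∣X∣≡k : ∣ X ∣ ≡ k
    ∣X∣≡k = trans (∣∣≡count centre X (lookup∘tabulate (λ i → centre (toℕ i)))) centre-count
    near : ∀ x → distToSet D X x ≤∞ fin ∣ toℕ x - assign (toℕ x) ∣
    near x = ≤∞-trans (distToSet-≤ D X x y∈X)
      (subst (λ z → D x y ≤∞ fin ∣ toℕ x - z ∣) toℕy (dist-≤-walk (isDist x y) walk))
      where
      x∈ : InRange 0 (suc m) (toℕ x)
      x∈ = z≤n , toℕ<n x
      y = fromℕ< (proj₂ (assign-inRange (toℕ x) x∈))
      toℕy : toℕ y ≡ assign (toℕ x)
      toℕy = toℕ-fromℕ< _
      y∈X : lookup X y ≡ true
      y∈X = trans (lookup∘tabulate (λ i → centre (toℕ i)) y) (trans (cong centre toℕy) (assign-centre _ x∈))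
      walk : PathWalk x y ∣ toℕ x - toℕ y ∣
      walk = linked-walk cut cut-toℕ x y (subst (Linked cut (toℕ x)) (sym toℕy) (assign-linked _ x∈))
    cost : medianCost D X ≤∞ fin C
    cost = ≤∞-trans (sum∞-mono (allFin (suc m)) near)
      (subst (_≤∞ fin C)
        (sym (trans (sum∞-fin (allFin (suc m)) (λ x → ∣ toℕ x - assign (toℕ x) ∣))
                    (cong fin (sumL-allFin (suc m) (λ v → ∣ v - assign v ∣)))))
        (fin≤fin assign-cost))

centres-within : ∀ B s (γ : Strategy (PathGraph (B + s))) → Feasible (PathGraph (B + s)) one B γ →
  ∀ D → (∀ u v → IsDist (PathGraph (B + s)) one γ u v (D u v)) →
  Σ (Subset (suc (B + s))) λ X → ∣ X ∣ ≡ suc B × medianCost D X ≤∞ fin (quarterSquare (suc s))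
centres-within B s γ feasible D isDist =
  placement-medianCost γ (onℕ γ) (onℕ-toℕ γ) D isDist
    (placement (onℕ γ) B s 0 (subst (_≤ B) (interdictionCost≡count γ (onℕ γ) (onℕ-toℕ γ)) feasible))

value-≤ : ∀ B s (γ : Strategy (PathGraph (B + s))) → Feasible (PathGraph (B + s)) one B γ →
  ∀ w → IsValue (PathGraph (B + s)) one (suc B) γ w → w ≤∞ fin (quarterSquare (suc s))
value-≤ B s γ feasible w (D , isDist , _ , minimal) with centres-within B s γ feasible D isDist
... | X , ∣X∣≡1+B , cost = ≤∞-trans (minimal X ∣X∣≡1+B) cost

-- The leaf strategy: i isolated vertices, a path on t + 1 vertices, q isolated vertices

module Leaf (i q t : ℕ) where

  G : Graph
  G = PathGraph (i + q + t)

  γ : Strategy G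
  γ = leafStrategy (i + q + t) (i + q) i

  K : ℕ
  K = (i + q + t) ∸ ((i + q) ∸ i)

  K≡i+t : K ≡ i + t
  K≡i+t = begin
    (i + q + t) ∸ ((i + q) ∸ i)  ≡⟨ cong ((i + q + t) ∸_) (m+n∸m≡n i q) ⟩
    (i + q + t) ∸ q              ≡⟨ cong (_∸ q) (shuffle i q t) ⟩
    (i + t + q) ∸ q              ≡⟨ m+n∸n≡m (i + t) q ⟩
    i + t                        ∎
    where
    open ≡-Reasoning
    shuffle : ∀ a b c → a + b + c ≡ a + c + b
    shuffle = solve-∀

  cut : ℕ → Bool
  cut j = does (j <? i) ∨ does (K ≤? j)

  Main : ℕ → Set
  Main v = i ≤ v × v ≤ K

  main? : ∀ v → Dec (Main v)
  main? v = (i ≤? v) ×-dec (v ≤? K)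

  main⇒inRange : ∀ {v} → Main v → InRange i (suc t) v
  main⇒inRange {v} (i≤v , v≤K) = i≤v , subst (v <_) (sym (+-suc i t)) (s≤s (subst (v ≤_) K≡i+t v≤K))

  inRange⇒main : ∀ {v} → InRange i (suc t) v → Main v
  inRange⇒main {v} r = proj₁ r , subst (v ≤_) (sym K≡i+t) (inRange-last r)

  main-uncut : ∀ {x y} → Main x → Main y → Uncut cut x y
  main-uncut (i≤x , _) (_ , y≤K) j x≤j j<y =
    cong₂ _∨_ (dec-false (j <? i) (≤⇒≯ (≤-trans i≤x x≤j))) (dec-false (K ≤? j) (<⇒≱ (<-≤-trans j<y y≤K)))

  uncut-main : ∀ e → γ e ≡ false → Main (toℕ e) × Main (suc (toℕ e))
  uncut-main e uncut = (i≤e , <⇒≤ e<K) , (m≤n⇒m≤1+n i≤e , e<K)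
    where
    i≤e = ≮⇒≥ (does-false (toℕ e <? i) (∨-conicalˡ _ _ uncut))
    e<K = ≰⇒> (does-false (K ≤? toℕ e) (∨-conicalʳ _ _ uncut))

  Vertex : Set
  Vertex = Fin (suc (i + q + t))

  BothMain : Vertex → Vertex → Set
  BothMain u v = Main (toℕ u) × Main (toℕ v)

  bothMain? : ∀ u v → Dec (BothMain u v)
  bothMain? u v = main? (toℕ u) ×-dec main? (toℕ v)

  isolatedDistance : Vertex → Vertex → ℕ∞
  isolatedDistance u v = if does (u ≟ᶠ v) then fin 0 else ∞

  distance : Vertex → Vertex → ℕ∞
  distance u v = if does (bothMain? u v) then fin ∣ toℕ u - toℕ v ∣ else isolatedDistance u v

  distance-main : ∀ {u v} → BothMain u v → distance u v ≡ fin ∣ toℕ u - toℕ v ∣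
  distance-main {u} {v} both =
    cong (if_then fin ∣ toℕ u - toℕ v ∣ else isolatedDistance u v) (dec-true (bothMain? u v) both)

  distance-outside : ∀ {u v} → ¬ BothMain u v → distance u v ≡ isolatedDistance u v
  distance-outside {u} {v} ¬both =
    cong (if_then fin ∣ toℕ u - toℕ v ∣ else isolatedDistance u v) (dec-false (bothMain? u v) ¬both)

  distance-apart : ∀ {u v} → ¬ BothMain u v → u ≢ v → distance u v ≡ ∞
  distance-apart {u} {v} ¬both u≢v =
    trans (distance-outside ¬both) (cong (if_then fin 0 else ∞) (dec-false (u ≟ᶠ v) u≢v))

  open PathWalks γ

  isDist : ∀ u v → IsDist G one γ u v (distance u v)
  isDist u v with bothMain? u v
  ... | yes (mu , mv) = subst (IsDist G one γ u v) (sym (distance-main (mu , mv)))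
        (linked-walk cut (λ _ → refl) u v (main-uncut mu mv , main-uncut mv mu) , λ _ → walk-length-≥)
  ... | no ¬both = subst (IsDist G one γ u v) (sym (distance-outside ¬both)) isolated
    where
    isolated : IsDist G one γ u v (if does (u ≟ᶠ v) then fin 0 else ∞)
    isolated with u ≟ᶠ v
    ... | yes refl = nil , λ _ _ → z≤n
    ... | no u≢v = λ _ walk → [ u≢v , ¬both ]′ (walk-confined Main uncut-main walk)

  count-cut : count cut 0 (i + q + t) ≡ i + q
  count-cut = begin
    count cut 0 (i + q + t)                                   ≡⟨ cong (count cut 0) (shuffle i q t) ⟩
    count cut 0 (i + (t + q))                                 ≡⟨ rangeSum-++₃ _ 0 i t q ⟩
    count cut 0 i + (count cut i t + count cut (i + t) q)     ≡⟨ cong₂ (λ x y → x + (y + count cut (i + t) q))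
                                                                   (count-allTrue cut 0 i left) (count-allFalse cut i t middle) ⟩
    i + count cut (i + t) q                                   ≡⟨ cong (i +_) (count-allTrue cut (i + t) q right) ⟩
    i + q                                                     ∎
    where
    open ≡-Reasoning
    shuffle : ∀ a b c → a + b + c ≡ a + (c + b)
    shuffle = solve-∀
    left : ∀ v → InRange 0 i v → cut v ≡ true
    left v (_ , v<i) = cong (_∨ does (K ≤? v)) (dec-true (v <? i) v<i)
    middle : ∀ v → InRange i t v → cut v ≡ false
    middle v (i≤v , v<) = main-uncut {i} {K} (≤-refl , i≤K) (i≤K , ≤-refl) v i≤v (subst (v <_) (sym K≡i+t) v<)
      where i≤K = subst (i ≤_) (sym K≡i+t) (m≤m+n i t)
    right : ∀ v → InRange (i + t) q v → cut v ≡ true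
    right v (≤v , _) = trans (cong (does (v <? i) ∨_) (dec-true (K ≤? v) (subst (_≤ v) (sym K≡i+t) ≤v)))
                             (∨-zeroʳ (does (v <? i)))

  feasible : Feasible G one (i + q) γ
  feasible = ≤-reflexive (trans (interdictionCost≡count γ cut (λ _ → refl)) count-cut)

  split-vertices : ∀ ψ → rangeSum ψ 0 (suc (i + q + t)) ≡
    rangeSum ψ 0 i + (rangeSum ψ i (suc t) + rangeSum ψ (i + suc t) q)
  split-vertices ψ = trans (cong (rangeSum ψ 0) (shuffle i q t)) (rangeSum-++₃ ψ 0 i (suc t) q)
    where
    shuffle : ∀ a b c → suc (a + b + c) ≡ a + (suc c + b)
    shuffle = solve-∀

  module _ (X : Subset (suc (i + q + t))) (∣X∣≡1+i+q : ∣ X ∣ ≡ suc (i + q)) where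

    centre? : ℕ → Bool
    centre? = onℕ (lookup X)

    uncovered : ∀ {v} → v < suc (i + q + t) → ¬ Main v → centre? v ≡ false → medianCost distance X ≡ ∞
    uncovered {v} v< ¬main v∉X =
      sum∞-∞ (distToSet distance X) (∈-allFin x) (≤∞-antisym x≤∞ (≤-distToSet distance X x far))
      where
      x = fromℕ< v<
      x∉X : lookup X x ≡ false
      x∉X = trans (sym (onℕ-toℕ (lookup X) x)) (trans (cong centre? (toℕ-fromℕ< v<)) v∉X)
      far : ∀ y → lookup X y ≡ true → ∞ ≤∞ distance x y
      far y y∈X = subst (∞ ≤∞_) (sym (distance-apart (λ (mx , _) → ¬main (subst Main (toℕ-fromℕ< v<) mx))
                    (λ x≡y → false≢true (trans (sym x∉X) (trans (cong (lookup X) x≡y) y∈X))))) x≤∞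

    module _ (left : ∀ v → InRange 0 i v → centre? v ≡ true)
             (right : ∀ v → InRange (i + suc t) q v → centre? v ≡ true) where

      main-count : count centre? i (suc t) ≡ 1
      main-count = +-cancelʳ-≡ q _ _ (+-cancelˡ-≡ i _ _ (begin
        i + (count centre? i (suc t) + q)
          ≡⟨ cong₂ (λ x y → x + (count centre? i (suc t) + y))
                   (count-allTrue centre? 0 i left) (count-allTrue centre? (i + suc t) q right) ⟨
        count centre? 0 i + (count centre? i (suc t) + count centre? (i + suc t) q)
          ≡⟨ split-vertices _ ⟨
        count centre? 0 (suc (i + q + t))
          ≡⟨ ∣∣≡count centre? X (λ j → sym (onℕ-toℕ (lookup X) j)) ⟨
        ∣ X ∣                                  ≡⟨ ∣X∣≡1+i+q ⟩
        suc (i + q)                            ≡⟨ +-suc i q ⟨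
        i + (1 + q)                            ∎))
        where open ≡-Reasoning

      c : ℕ
      c = proj₁ (count≡1⇒unique centre? i (suc t) main-count)

      only-c : ∀ {v} → Main v → centre? v ≡ true → v ≡ c
      only-c {v} mv = proj₂ (proj₂ (proj₂ (count≡1⇒unique centre? i (suc t) main-count))) v (main⇒inRange mv)

      mainCost : ℕ → ℕ
      mainCost v = if does (main? v) then ∣ v - c ∣ else 0

      mainCost-main : ∀ {v} → Main v → mainCost v ≡ ∣ v - c ∣
      mainCost-main {v} mv = cong (if_then ∣ v - c ∣ else 0) (dec-true (main? v) mv)

      mainCost-outside : ∀ {v} → ¬ Main v → mainCost v ≡ 0
      mainCost-outside {v} ¬mv = cong (if_then ∣ v - c ∣ else 0) (dec-false (main? v) ¬mv)

      c-nearest : ∀ {x} → Main (toℕ x) → ∀ y → lookup X y ≡ true → fin ∣ toℕ x - c ∣ ≤∞ distance x y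
      c-nearest {x} mx y y∈X with main? (toℕ y)
      ... | yes my = subst (fin ∣ toℕ x - c ∣ ≤∞_) (sym (distance-main (mx , my)))
                       (fin≤fin (≤-reflexive (cong (λ z → ∣ toℕ x - z ∣)
                         (sym (only-c my (trans (onℕ-toℕ (lookup X) y) y∈X))))))
      ... | no ¬my = subst (fin ∣ toℕ x - c ∣ ≤∞_)
                       (sym (distance-apart (λ (_ , my) → ¬my my) (λ x≡y → ¬my (subst (λ z → Main (toℕ z)) x≡y mx))))
                       x≤∞

      mainCost-≤ : ∀ x → fin (mainCost (toℕ x)) ≤∞ distToSet distance X x
      mainCost-≤ x with main? (toℕ x)
      ... | no ¬mx = subst (λ n → fin n ≤∞ distToSet distance X x) (sym (mainCost-outside ¬mx)) (0≤∞ _)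
      ... | yes mx = subst (λ n → fin n ≤∞ distToSet distance X x) (sym (mainCost-main mx))
                       (≤-distToSet distance X x (c-nearest mx))

      quarterSquare-≤-mainCost : quarterSquare (suc t) ≤ rangeSum mainCost 0 (suc (i + q + t))
      quarterSquare-≤-mainCost = begin
        quarterSquare (suc t)                 ≤⟨ quarterSquare-≤-rangeSum (suc t) i c ⟩
        rangeSum (λ v → ∣ v - c ∣) i (suc t)  ≡⟨ rangeSum-cong i (suc t) (λ v r → mainCost-main (inRange⇒main r)) ⟨
        rangeSum mainCost i (suc t)           ≤⟨ ≤-trans (m≤m+n _ (rangeSum mainCost (i + suc t) q))
                                                         (m≤n+m _ (rangeSum mainCost 0 i)) ⟩
        rangeSum mainCost 0 i + (rangeSum mainCost i (suc t) + rangeSum mainCost (i + suc t) q)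
                                              ≡⟨ split-vertices mainCost ⟨
        rangeSum mainCost 0 (suc (i + q + t)) ∎
        where open ≤-Reasoning

      all-covered : fin (quarterSquare (suc t)) ≤∞ medianCost distance X
      all-covered = ≤∞-trans (fin≤fin quarterSquare-≤-mainCost)
        (subst (_≤∞ medianCost distance X)
          (trans (sum∞-fin (allFin (suc (i + q + t))) (λ x → mainCost (toℕ x)))
                 (cong fin (sumL-allFin (suc (i + q + t)) mainCost)))
          (sum∞-mono (allFin (suc (i + q + t))) mainCost-≤))

    lower-bound : fin (quarterSquare (suc t)) ≤∞ medianCost distance X
    lower-bound with all-or-counterexample centre? 0 i | all-or-counterexample centre? (i + suc t) q
    ... | inj₂ (v , (_ , v<i) , v∉X) | _ =
          subst (_ ≤∞_) (sym (uncovered v< (λ (i≤v , _) → <⇒≱ v<i i≤v) v∉X)) x≤∞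
      where
      v< : v < suc (i + q + t)
      v< = <-≤-trans v<i (m≤n⇒m≤1+n (≤-trans (m≤m+n i q) (m≤m+n (i + q) t)))
    ... | inj₁ _ | inj₂ (v , (≤v , v<) , v∉X) =
          subst (_ ≤∞_) (sym (uncovered v<′ (λ (_ , v≤K) → <⇒≱ K<v v≤K) v∉X)) x≤∞
      where
      shuffle : ∀ a b c → a + suc b + c ≡ suc (a + c + b)
      shuffle = solve-∀
      v<′ : v < suc (i + q + t)
      v<′ = subst (v <_) (shuffle i t q) v<
      K<v : K < v
      K<v = subst (_< v) (sym K≡i+t) (subst (_≤ v) (+-suc i t) ≤v)
    ... | inj₁ left | inj₁ right = all-covered left right

  value : IsValue G one (suc (i + q)) γ (fin (quarterSquare (suc t)))
  value with centres-within (i + q) t γ feasible distance isDist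
  ... | X , ∣X∣≡1+i+q , cost =
    distance , isDist , (X , ∣X∣≡1+i+q , ≤∞-antisym cost (lower-bound X ∣X∣≡1+i+q)) , lower-bound


lemma3 : (m : ℕ) → 1 ≤ m → (B : ℕ) → B ≤ m → (i : ℕ) → i ≤ B →
    IsOptimal (PathGraph m) one one B (suc B) (leafStrategy m B i)
lemma3 m _ B B≤m i i≤B with m≤n⇒∃[o]m+o≡n B≤m
... | t , refl with m≤n⇒∃[o]m+o≡n i≤B
...   | q , refl = feasible , fin (quarterSquare (suc t)) , value , value-≤ (i + q) t
  where open Leaf i q t
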